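{- Let $T \in \mathcal{Y}_5$ have shape $(3,2)$ or $(2,2,1)$. Then $T$ is reconstructible from its set of $1$-minors: if $T' \in \mathcal{Y}_5$ has the same set of $1$-minors as $T$, then $T' = T$.
   Context: A partition $\lambda$ of $n$ is a non-increasing finite sequence $(\lambda_1,\ldots,\lambda_m)$ of positive integers summing to $n$; its Young diagram is a left-aligned array of cells with $\lambda_h$ cells in row $h$ (rows counted from the top). A standard Young tableau of shape $\lambda$ is a filling of the Young diagram of $\lambda$ with $1,\ldots,n$, each exactly once, increasing left to right along rows and top to bottom down columns; $\mathcal{Y}_n$ denotes the set of standard Young tableaux with $n$ entries. For $T \in \mathcal{Y}_n$ and $m \in \{1,\ldots,n\}$, the tableau $T - m \in \mathcal{Y}_{n-1}$ is obtained as follows: remove the cell containing $m$, leaving a space; repeatedly, let $R$ be the cell immediately right of the space and $B$ the cell immediately below it (if they exist); if $R$ exists and ($B$ does not exist or the entry of $R$ is smaller than that of $B$), slide $R$ into the space; otherwise, if $B$ exists, slide $B$ into the space; if neither exists, stop (jeu de taquin). Finally renumber every entry $p > m$ as $p-1$. The set of $1$-minors of $T$ is $\{T - m : 1 \leq m \leq n\}$. -}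

module Defs where

open import Data.Nat using (ℕ; zero; suc; _<_; _<ᵇ_; _∸_; _≤ᵇ_)
open import Data.Nat.Properties using (_≟_)
open import Data.Bool using (Bool; true; false; if_then_else_)
open import Data.List using (List; []; _∷_; _++_; [_]; map; concat; take; drop; upTo; length)
open import Data.Maybe using (Maybe; just; nothing)
open import Data.Product using (_×_; _,_)
open import Data.Unit using (⊤)
open import Data.Empty using (⊥)
open import Relation.Nullary using (¬_; yes; no)
open import Relation.Binary.PropositionalEquality using (_≡_)
open import Data.List.Relation.Unary.All using (All)
open import Data.List.Relation.Unary.Linked using (Linked)
open import Data.List.Relation.Binary.Permutation.Propositional using (_↭_)

-- A tableau is a list of rows (top row first), each row a list of entries (left to right).
Tableau : Set
Tableau = List (List ℕ)

shape : Tableau → List ℕ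
shape = map length

ColLt : List ℕ → List ℕ → Set
ColLt _ [] = ⊤
ColLt [] (_ ∷ _) = ⊥
ColLt (a ∷ as) (b ∷ bs) = (a < b) × ColLt as bs

record IsSYT (n : ℕ) (T : Tableau) : Set where
  field
    rowsNonempty : All (λ r → ¬ (r ≡ [])) T
    rowsIncr     : All (Linked _<_) T
    colsIncr     : Linked ColLt T
    entries      : concat T ↭ map suc (upTo n)

at : List ℕ → ℕ → Maybe ℕ
at [] _ = nothing
at (x ∷ xs) zero = just x
at (x ∷ xs) (suc j) = at xs j

-- jeu de taquin slide. The space is in the current row, which is  pre ++ [space] ++ suf,
-- so the space is at column  length pre ; the last argument lists the rows below.
-- If there is no row below, the space slides right to the end of its row and is dropped.
mutual
  slide : List ℕ → List ℕ → List (List ℕ) → List (List ℕ)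
  slide pre suf [] = (pre ++ suf) ∷ []
  slide pre suf (row ∷ rest) = slideOver row rest pre suf

  slideOver : List ℕ → List (List ℕ) → List ℕ → List ℕ → List (List ℕ)
  slideOver row rest pre suf = step row rest pre suf (at row (length pre))

  step : List ℕ → List (List ℕ) → List ℕ → List ℕ → Maybe ℕ → List (List ℕ)
  step row rest pre [] nothing = pre ∷ row ∷ rest
  step row rest pre [] (just b) = (pre ++ [ b ]) ∷ slide (take (length pre) row) (drop (suc (length pre)) row) rest
  step row rest pre (r ∷ suf) nothing = slideOver row rest (pre ++ [ r ]) suf
  step row rest pre (r ∷ suf) (just b) =
    if r <ᵇ b
      then slideOver row rest (pre ++ [ r ]) suf
      else (pre ++ b ∷ r ∷ suf) ∷ slide (take (length pre) row) (drop (suc (length pre)) row) rest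

splitAt : ℕ → List ℕ → Maybe (List ℕ × List ℕ)
splitAt m [] = nothing
splitAt m (x ∷ xs) with x ≟ m
... | yes _ = just ([] , xs)
... | no _ with splitAt m xs
...   | nothing = nothing
...   | just (p , s) = just (x ∷ p , s)

removeSlide : ℕ → Tableau → Tableau
removeSlide m [] = []
removeSlide m (row ∷ rest) with splitAt m row
... | just (pre , suf) = slide pre suf rest
... | nothing = row ∷ removeSlide m rest

-- drop empty rows (only a vacated last row can be empty)
dropEmpty : Tableau → Tableau
dropEmpty [] = []
dropEmpty ([] ∷ rs) = dropEmpty rs
dropEmpty ((x ∷ xs) ∷ rs) = (x ∷ xs) ∷ dropEmpty rs

renum : ℕ → ℕ → ℕ
renum m p = if m <ᵇ p then p ∸ 1 else p

_⊖_ : Tableau → ℕ → Tableau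
T ⊖ m = map (map (renum m)) (dropEmpty (removeSlide m T))

-- the list of 1-minors T - m, m = 1,…,n (viewed as a set via membership)
minors : ℕ → Tableau → List Tableau
minors n T = map (T ⊖_) (map suc (upTo n))

-- A standard Young tableau is its row word cut into nonempty blocks, and the row word is a
-- permutation of 1,…,n.  So the standard tableaux with n entries all occur among the cuttings of
-- the words of length n using every letter 1,…,n, which reduces the theorem to a finite
-- computation: there are 26 standard tableaux with 5 entries, and each of the ten of shape (3,2)
-- or (2,2,1) is the only one among them with its set of 1-minors.
module Submission where

open import Defs
open import Data.Nat using (ℕ; suc; _<_)
open import Data.Nat.Properties using (_<?_; _≟_)
open import Data.List using (List; []; _∷_; [_]; _++_; concat; concatMap; map; filter; upTo; length; cartesianProductWith)
open import Data.List.Properties using (≡-dec; length-map; length-upTo)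
open import Data.List.Membership.Propositional using (_∈_)
open import Data.List.Membership.Propositional.Properties using (∈-concat⁺′; ∈-map⁺; ∈-filter⁺; ∈-cartesianProductWith⁺)
open import Data.List.Membership.DecPropositional (≡-dec (≡-dec _≟_)) using () renaming (_∈?_ to _∈ᵀ?_)
open import Data.List.Membership.DecPropositional _≟_ using () renaming (_∈?_ to _∈ᴺ?_)
open import Data.List.Relation.Unary.All as All using (All; []; _∷_; all?)
open import Data.List.Relation.Unary.Any using (here; there)
open import Data.List.Relation.Unary.Linked using (Linked; linked?)
open import Data.List.Relation.Binary.Permutation.Propositional using (↭-sym)
open import Data.List.Relation.Binary.Permutation.Propositional.Properties using (∈-resp-↭; ↭-length)
open import Data.Product using (_×_; _,_)
open import Data.Sum using (_⊎_)
open import Data.Unit using (tt)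
open import Data.Empty using (⊥-elim)
open import Function.Bundles using (_⇔_; Equivalence)
open import Relation.Nullary using (Dec; yes; no; ¬_)
open import Relation.Nullary.Decidable using (_×-dec_; _⊎-dec_; _→-dec_; from-yes)
open import Relation.Unary using (Decidable)
open import Relation.Binary.PropositionalEquality using (_≡_; refl; trans; subst)

private
  variable
    A : Set

words : ℕ → List A → List (List A)
words 0       xs = [ [] ]
words (suc n) xs = cartesianProductWith _∷_ xs (words n xs)

words-complete : ∀ {xs w : List A} → All (_∈ xs) w → w ∈ words (length w) xs
words-complete []       = here refl
words-complete (p ∷ ps) = ∈-cartesianProductWith⁺ _∷_ p (words-complete ps)

joinFirst : A → List (List A) → List (List (List A))
joinFirst x []       = []
joinFirst x (b ∷ bs) = [ (x ∷ b) ∷ bs ]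

startOrJoin : A → List (List A) → List (List (List A))
startOrJoin x bs = ([ x ] ∷ bs) ∷ joinFirst x bs

segmentations : List A → List (List (List A))
segmentations []       = [ [] ]
segmentations (x ∷ xs) = concatMap (startOrJoin x) (segmentations xs)

NonEmpty : List A → Set
NonEmpty xs = ¬ (xs ≡ [])

mutual
  segmentations-complete : ∀ {xss : List (List A)} → All NonEmpty xss →
                           xss ∈ segmentations (concat xss)
  segmentations-complete []                          = here refl
  segmentations-complete {xss = [] ∷ _}      (ne ∷ _)  = ⊥-elim (ne refl)
  segmentations-complete {xss = (x ∷ r) ∷ _} (_ ∷ nes) = segmentations-complete-∷ x r nes

  segmentations-complete-∷ : ∀ (x : A) r {rs} → All NonEmpty rs →
                             ((x ∷ r) ∷ rs) ∈ segmentations (x ∷ r ++ concat rs)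
  segmentations-complete-∷ x [] nes =
    ∈-concat⁺′ (here refl) (∈-map⁺ (startOrJoin x) (segmentations-complete nes))
  segmentations-complete-∷ x (y ∷ r) nes =
    ∈-concat⁺′ (there (here refl)) (∈-map⁺ (startOrJoin x) (segmentations-complete-∷ y r nes))

labels : ℕ → List ℕ
labels n = map suc (upTo n)

colLt? : (r s : List ℕ) → Dec (ColLt r s)
colLt? _        []       = yes tt
colLt? []       (_ ∷ _)  = no λ ()
colLt? (a ∷ as) (b ∷ bs) = a <? b ×-dec colLt? as bs

Standard : Tableau → Set
Standard T = All (Linked _<_) T × Linked ColLt T

standard? : Decidable Standard
standard? T = all? (linked? _<?_) T ×-dec linked? colLt? T

Covers : ℕ → List ℕ → Set
Covers n w = All (_∈ w) (labels n)

covers? : ∀ n → Decidable (Covers n)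
covers? n w = all? (_∈ᴺ? w) (labels n)

standardTableaux : ℕ → List Tableau
standardTableaux n =
  filter standard? (concatMap segmentations (filter (covers? n) (words n (labels n))))

module _ {n T} (syt : IsSYT n T) where
  open IsSYT syt

  size-concat : length (concat T) ≡ n
  size-concat = trans (↭-length entries) (trans (length-map suc (upTo n)) (length-upTo n))

  standardTableaux-complete : T ∈ standardTableaux n
  standardTableaux-complete =
    ∈-filter⁺ standard?
      (∈-concat⁺′ (segmentations-complete rowsNonempty)
        (∈-map⁺ segmentations (∈-filter⁺ (covers? n) word∈ covered)))
      (rowsIncr , colsIncr)
    where
    word∈ : concat T ∈ words n (labels n)
    word∈ = subst (λ k → concat T ∈ words k (labels n)) size-concat
                  (words-complete (All.tabulate (∈-resp-↭ entries)))

    covered : Covers n (concat T)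
    covered = All.tabulate (∈-resp-↭ (↭-sym entries))

_≟ᵀ_ : (T T′ : Tableau) → Dec (T ≡ T′)
_≟ᵀ_ = ≡-dec (≡-dec _≟_)

MinorsSubset : ℕ → Tableau → Tableau → Set
MinorsSubset n T T′ = All (_∈ minors n T′) (minors n T)

minorsSubset? : ∀ n T T′ → Dec (MinorsSubset n T T′)
minorsSubset? n T T′ = all? (_∈ᵀ? minors n T′) (minors n T)

DeterminedByMinors : ℕ → Tableau → Set
DeterminedByMinors n T =
  All (λ T′ → MinorsSubset n T T′ → MinorsSubset n T′ T → T′ ≡ T) (standardTableaux n)

determinedByMinors? : ∀ n → Decidable (DeterminedByMinors n)
determinedByMinors? n T =
  all? (λ T′ → minorsSubset? n T T′ →-dec minorsSubset? n T′ T →-dec T′ ≟ᵀ T) (standardTableaux n)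

Shape32or221 : Tableau → Set
Shape32or221 T = shape T ≡ 3 ∷ 2 ∷ [] ⊎ shape T ≡ 2 ∷ 2 ∷ 1 ∷ []

shape32or221? : Decidable Shape32or221
shape32or221? T = ≡-dec _≟_ (shape T) (3 ∷ 2 ∷ []) ⊎-dec ≡-dec _≟_ (shape T) (2 ∷ 2 ∷ 1 ∷ [])

shape32or221-determinedByMinors :
  All (λ T → Shape32or221 T → DeterminedByMinors 5 T) (standardTableaux 5)
shape32or221-determinedByMinors =
  from-yes (all? (λ T → shape32or221? T →-dec determinedByMinors? 5 T) (standardTableaux 5))

mainTheorem6 : (T : Tableau) → IsSYT 5 T
    → (shape T ≡ 3 ∷ 2 ∷ [] ⊎ shape T ≡ 2 ∷ 2 ∷ 1 ∷ [])
    → (T′ : Tableau) → IsSYT 5 T′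
    → (∀ S → (S ∈ minors 5 T) ⇔ (S ∈ minors 5 T′))
    → T′ ≡ T
mainTheorem6 T syt shapeT T′ syt′ sameMinors =
  All.lookup (All.lookup shape32or221-determinedByMinors (standardTableaux-complete syt) shapeT)
             (standardTableaux-complete syt′)
             (All.tabulate (Equivalence.to (sameMinors _)))
             (All.tabulate (Equivalence.from (sameMinors _)))
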